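{- Let $\xi\in\Lambda$, $\pi\in\Pi$ with $\xi\star\pi\in\perp\!\!\!\perp$, and let $t_0,\dots,t_N,t,u\in\Lambda$ be arbitrary terms. Let $\xi'\star\pi'$ be obtained from $\xi\star\pi$ by replacing some occurrences of $\mathsf A$ by $(\ell_u)\mathsf A=\mathsf k_{u\cdot\pi_0}$ and some occurrences of the variables $\mathsf q_0,\dots,\mathsf q_N$ by $t_0,\dots,t_N$ respectively. Then $\xi'\star\pi'\in\perp\!\!\!\perp$ and $\xi'\star\pi'\cdot t\in\perp\!\!\!\perp$.
   Context: Fix an integer $N\ge 0$. The BBC realizability algebra $(\Lambda,\Pi,\perp\!\!\!\perp)$: terms $\Lambda$ form the smallest set containing constants $\mathsf B,\mathsf C,\mathsf I,\mathsf K,\mathsf W,\mathsf{cc},\mathsf A$ and $\mathsf p,\mathsf q_0,\dots,\mathsf q_N$, closed under application $(\xi)\eta$, and such that to every sequence $(\xi_i)_{i\in\mathbb N}$ of closed terms (no occurrence of $\mathsf p,\mathsf q_0,\dots,\mathsf q_N$) is associated injectively and well-foundedly a new constant $\bigwedge_i\xi_i$. Each term is a finite string of constants and parentheses, and "occurrences" refer to this string (in $\xi$ and in the terms of the stack). Stacks: $t_0\cdot\ldots\cdot t_{n-1}\cdot\pi_0$, $\pi_0$ the empty stack; if $\pi=t_0\cdot\ldots\cdot t_{n-1}\cdot\pi_0$ then $\pi\cdot t$ denotes $t_0\cdot\ldots\cdot t_{n-1}\cdot t\cdot\pi_0$. Continuations $\mathsf k_{\pi_0}=\mathsf A$, $\mathsf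 k_{t\cdot\pi}=(\ell_t)\mathsf k_\pi$, $\ell_t=((\mathsf C)(\mathsf B)\mathsf C\mathsf B)t$; integers $\underline 0=(\mathsf K)\mathsf I$, $\underline{n+1}=(\sigma)\underline n$, $\sigma=(\mathsf B\mathsf W)(\mathsf C)(\mathsf B)\mathsf B\mathsf B$. Execution $\succ$: least preorder with $(\xi)\eta\star\pi\succ\xi\star\eta\cdot\pi$; $\mathsf B\star\xi\cdot\eta\cdot\zeta\cdot\pi\succ\xi\star(\eta)\zeta\cdot\pi$; $\mathsf C\star\xi\cdot\eta\cdot\zeta\cdot\pi\succ\xi\star\zeta\cdot\eta\cdot\pi$; $\mathsf I\star\xi\cdot\pi\succ\xi\star\pi$; $\mathsf K\star\xi\cdot\eta\cdot\pi\succ\xi\star\pi$; $\mathsf W\star\xi\cdot\eta\cdot\pi\succ\xi\star\eta\cdot\eta\cdot\pi$; $\mathsf{cc}\star\xi\cdot\pi\succ\xi\star\mathsf k_\pi\cdot\pi$; $\mathsf A\star\xi\cdot\pi\succ\xi\star\pi_0$; $\bigwedge_i\xi_i\star\underline n\cdot\pi\succ\xi_n\star\pi$. Pole $\perp\!\!\!\perp=\{\xi\star\pi:\exists\varpi,\ \xi\star\pi\succ\mathsf p\star\varpi\}$. -}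

module Defs where

open import Data.Nat using (ℕ; zero; suc)
open import Data.Fin using (Fin)
open import Data.Bool using (Bool; true; false)
open import Data.List using (List; []; _∷_; _++_; [_])
open import Data.Product using (_×_; _,_; ∃)
open import Relation.Binary.Construct.Closure.ReflexiveTransitive using (Star)

-- Tm N true  = Λ (all terms, may contain p, q₀ … q_N)
-- Tm N false = closed terms (no occurrence of p, q₀ … q_N)
-- The infinitary constant ⋀ takes a sequence of closed terms; as a constructor it is
-- automatically injective and well-founded.  Occurrences inside ⋀ are NOT
-- occurrences in the string (⋀ᵢξᵢ is a single constant).
data Tm (N : ℕ) : Bool → Set where
  `B `C `I `K `W `cc `A : ∀ {b} → Tm N b
  `p : Tm N true
  `q : Fin (suc N) → Tm N true
  ⋀ : ∀ {b} → (ℕ → Tm N false) → Tm N b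
  _·_ : ∀ {b} → Tm N b → Tm N b → Tm N b

infixl 7 _·_

Λ : ℕ → Set
Λ N = Tm N true

emb : ∀ {N} → Tm N false → Λ N
emb `B = `B
emb `C = `C
emb `I = `I
emb `K = `K
emb `W = `W
emb `cc = `cc
emb `A = `A
emb (⋀ f) = ⋀ f
emb (x · y) = emb x · emb y

-- stacks t₀·…·t_{n-1}·π₀ ; π₀ = [] ; π·t = π ++ [ t ]
Π : ℕ → Set
Π N = List (Λ N)

ℓ : ∀ {N} → Λ N → Λ N
ℓ t = (`C · (`B · `C · `B)) · t

k : ∀ {N} → Π N → Λ N
k [] = `A
k (t ∷ π) = ℓ t · k π

σ : ∀ {N b} → Tm N b
σ = (`B · `W) · (`C · (`B · `B · `B))

num : ∀ {N b} → ℕ → Tm N b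
num zero = `K · `I
num (suc n) = σ · num n

Proc : ℕ → Set
Proc N = Λ N × Π N

data _↦_ {N : ℕ} : Proc N → Proc N → Set where
  push : ∀ {ξ η π} → (ξ · η , π) ↦ (ξ , η ∷ π)
  stB  : ∀ {ξ η ζ π} → (`B , ξ ∷ η ∷ ζ ∷ π) ↦ (ξ , (η · ζ) ∷ π)
  stC  : ∀ {ξ η ζ π} → (`C , ξ ∷ η ∷ ζ ∷ π) ↦ (ξ , ζ ∷ η ∷ π)
  stI  : ∀ {ξ π} → (`I , ξ ∷ π) ↦ (ξ , π)
  stK  : ∀ {ξ η π} → (`K , ξ ∷ η ∷ π) ↦ (ξ , π)
  stW  : ∀ {ξ η π} → (`W , ξ ∷ η ∷ π) ↦ (ξ , η ∷ η ∷ π)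
  stcc : ∀ {ξ π} → (`cc , ξ ∷ π) ↦ (ξ , k π ∷ π)
  stA  : ∀ {ξ π} → (`A , ξ ∷ π) ↦ (ξ , [])
  st⋀  : ∀ {f n π} → (⋀ f , num n ∷ π) ↦ (emb (f n) , π)

_≻_ : ∀ {N} → Proc N → Proc N → Set
_≻_ = Star _↦_

⫫ : ∀ {N} → Proc N → Set
⫫ {N} (ξ , π) = ∃ λ (ϖ : Π N) → (ξ , π) ≻ (`p , ϖ)

data Repl {N : ℕ} (u : Λ N) (ts : Fin (suc N) → Λ N) : Λ N → Λ N → Set where
  keep : ∀ {x} → Repl u ts x x
  repA : Repl u ts `A (k (u ∷ []))
  repq : ∀ i → Repl u ts (`q i) (ts i)
  app  : ∀ {x x' y y'} → Repl u ts x x' → Repl u ts y y' → Repl u ts (x · y) (x' · y')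

data ReplΠ {N : ℕ} (u : Λ N) (ts : Fin (suc N) → Λ N) : Π N → Π N → Set where
  [] : ReplΠ u ts [] []
  _∷_ : ∀ {x x' π π'} → Repl u ts x x' → ReplΠ u ts π π' → ReplΠ u ts (x ∷ π) (x' ∷ π')

module Submission where

-- Replacing occurrences of A by a continuation and of q_i by t_i
-- is a simulation of the Krivine machine.  We work with a more general
-- replacement x ⊑ y, in which each A may become any continuation k_e (not only
-- k_{u·π₀}); this is needed because cc stores the current stack in a
-- continuation, whose final A then gets replaced by k_e where e is an extra tail
-- appended to the stack.
-- The theorem is the case e = π₀ and e = t·π₀, after embedding Repl into ⊑.

open import Defs
open import Data.Nat using (ℕ; suc; zero)
open import Data.Fin using (Fin)
open import Data.List using ([]; _∷_; _++_; [_])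
open import Data.List.Properties using (++-identityʳ)
open import Data.List.Relation.Binary.Pointwise using (Pointwise; []; _∷_)
open import Data.Product using (_×_; _,_)
open import Relation.Binary.Construct.Closure.ReflexiveTransitive using (ε; _◅_; _◅◅_)
open import Relation.Binary.PropositionalEquality using (_≡_; refl; cong₂; subst)

ℓ-step : ∀ {N} (t y x : Λ N) (s : Π N) → (ℓ t , y ∷ x ∷ s) ≻ (y , x · t ∷ s)
ℓ-step t y x s = push ◅ push ◅ stC ◅ push ◅ push ◅ stB ◅ stC ◅ push ◅ stB ◅ ε

continuation-resumes : ∀ {N} (e : Π N) (x : Λ N) (s : Π N) → (k e , x ∷ s) ≻ (x , e)
continuation-resumes []      x s = stA ◅ ε
continuation-resumes (t ∷ e) x s =
  push ◅ (ℓ-step t (k e) x s ◅◅ (continuation-resumes e (x · t) s ◅◅ (push ◅ ε)))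

data Inert {N : ℕ} : Λ N → Set where
  `B : Inert `B
  `C : Inert `C
  `I : Inert `I
  `K : Inert `K
  `W : Inert `W
  `cc : Inert `cc
  `p : Inert `p
  ⋀ : ∀ f → Inert (⋀ f)
  _·_ : ∀ {x y} → Inert x → Inert y → Inert (x · y)

num-inert : ∀ {N} (n : ℕ) → Inert {N} (num n)
num-inert zero    = `K · `I
num-inert (suc n) = (`B · `W) · (`C · ((`B · `B) · `B)) · num-inert n

module Simulation {N : ℕ} (ts : Fin (suc N) → Λ N) where

  data _⊑_ : Λ N → Λ N → Set where
    keep : ∀ {x} → x ⊑ x
    repA : ∀ e → `A ⊑ k e
    repq : ∀ i → `q i ⊑ ts i
    app  : ∀ {x x' y y'} → x ⊑ x' → y ⊑ y' → (x · y) ⊑ (x' · y')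

  _⊑ˢ_ : Π N → Π N → Set
  _⊑ˢ_ = Pointwise _⊑_

  inert-⊑ : ∀ {x y} → Inert x → x ⊑ y → y ≡ x
  inert-⊑ i       keep      = refl
  inert-⊑ (i · j) (app r s) = cong₂ _·_ (inert-⊑ i r) (inert-⊑ j s)

  -- The continuation k_π becomes k_{π'·e}: the final A of k_π is replaced by k_e.
  continuation-⊑ : ∀ {π π'} → π ⊑ˢ π' → ∀ e → k π ⊑ k (π' ++ e)
  continuation-⊑ []       e = repA e
  continuation-⊑ (r ∷ rs) e = app (app keep r) (continuation-⊑ rs e)

  record Reaches (source : Proc N) (η : Λ N) (ρ : Π N) : Set where
    constructor reaches
    field
      {η'} : Λ N
      {ρ' e'} : Π N
      run : source ≻ (η' , ρ' ++ e')
      η⊑ : η ⊑ η'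
      ρ⊑ : ρ ⊑ˢ ρ'

  -- One execution step is simulated by the replaced process with any tail e.
  -- Only A replaced by k_{e₀} behaves differently: it resumes e₀ instead of π₀.
  step-sim : ∀ {ξ π η ρ ξ' π'} → (ξ , π) ↦ (η , ρ) → ξ ⊑ ξ' → π ⊑ˢ π' →
             ∀ e → Reaches (ξ' , π' ++ e) η ρ
  step-sim push keep        rs           e = reaches (push ◅ ε) keep (keep ∷ rs)
  step-sim push (app r₁ r₂) rs           e = reaches (push ◅ ε) r₁ (r₂ ∷ rs)
  step-sim stB  keep (a ∷ b ∷ c ∷ rs)    e = reaches (stB ◅ ε) a (app b c ∷ rs)
  step-sim stC  keep (a ∷ b ∷ c ∷ rs)    e = reaches (stC ◅ ε) a (c ∷ b ∷ rs)
  step-sim stI  keep (a ∷ rs)            e = reaches (stI ◅ ε) a rs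
  step-sim stK  keep (a ∷ b ∷ rs)        e = reaches (stK ◅ ε) a rs
  step-sim stW  keep (a ∷ b ∷ rs)        e = reaches (stW ◅ ε) a (b ∷ b ∷ rs)
  step-sim stcc keep (a ∷ rs)            e =
    reaches {e' = e} (stcc ◅ ε) a (continuation-⊑ rs e ∷ rs)
  step-sim stA  keep (a ∷ rs)            e = reaches {e' = []} (stA ◅ ε) a []
  step-sim stA  (repA e₀) (_∷_ {ys = π'} a rs) e =
    reaches {e' = e₀} (continuation-resumes e₀ _ (π' ++ e)) a []
  step-sim (st⋀ {n = n}) keep (a ∷ rs)   e
    with refl ← inert-⊑ (num-inert n) a = reaches (st⋀ ◅ ε) keep rs

  pole-sim : ∀ {ξ π ϖ ξ' π'} → (ξ , π) ≻ (`p , ϖ) → ξ ⊑ ξ' → π ⊑ˢ π' →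
             ∀ e → ⫫ (ξ' , π' ++ e)
  pole-sim ε        keep rs e = _ , ε
  pole-sim (s ◅ ss) r    rs e with reaches run η⊑ ρ⊑ ← step-sim s r rs e
                              with ϖ' , run' ← pole-sim ss η⊑ ρ⊑ _ = ϖ' , (run ◅◅ run')

  repl-⊑ : ∀ {u x y} → Repl u ts x y → x ⊑ y
  repl-⊑ keep      = keep
  repl-⊑ repA      = repA _
  repl-⊑ (repq i)  = repq i
  repl-⊑ (app r s) = app (repl-⊑ r) (repl-⊑ s)

  replΠ-⊑ : ∀ {u π π'} → ReplΠ u ts π π' → π ⊑ˢ π'
  replΠ-⊑ []       = []
  replΠ-⊑ (r ∷ rs) = repl-⊑ r ∷ replΠ-⊑ rs

open Simulation using (pole-sim; repl-⊑; replΠ-⊑)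

lemma5 : (N : ℕ) (ξ : Λ N) (π : Π N) → ⫫ (ξ , π) →
         (ts : Fin (suc N) → Λ N) (t u : Λ N) (ξ' : Λ N) (π' : Π N) →
         Repl u ts ξ ξ' → ReplΠ u ts π π' →
         ⫫ (ξ' , π') × ⫫ (ξ' , π' ++ [ t ])
lemma5 N ξ π (_ , run) ts t u ξ' π' r rs =
  subst (λ s → ⫫ (ξ' , s)) (++-identityʳ π') (with-tail []) , with-tail [ t ]
  where
    with-tail : ∀ e → ⫫ (ξ' , π' ++ e)
    with-tail = pole-sim ts run (repl-⊑ ts r) (replΠ-⊑ ts rs)
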